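{- The functor $G$ from the category $S4_{\Box\Diamond}$ to $\mathit{Rel}$ is faithful. That is, for arrow terms $f,g$ of $S4_{\Box\Diamond}$ of the same type, $Gf = Gg$ implies $f = g$ in $S4_{\Box\Diamond}$.
   Context: A modality is a finite (possibly empty) word over the alphabet $\{\Box, \Diamond\}$. For a modality $A$ and $M \in \{\Box, \Diamond\}$, $MA$ denotes the word obtained by prefixing $M$. The category $S4_{\Box\Diamond}$ has the modalities as objects. Its primitive arrow terms are, for every modality $A$: - $\mathbf{1}_A : A \vdash A$; - $\varepsilon^\Box_A : \Box A \vdash A$ and $\varepsilon^\Diamond_A : A \vdash \Diamond A$; - $\delta^{\Box\Box}_A : \Box A \vdash \Box\Box A$ and $\delta^{\Diamond\Diamond}_A : \Diamond\Diamond A \vdash \Diamond A$. Arrow terms are closed under two operations: composition (if $f : A \vdash B$ and $g : B \vdash C$ then $g \circ f : A \vdash C$), and, for $M \in \{\Box, \Diamond\}$, if $f : A \vdash B$ then $Mf : MA \vdash MB$. Arrows are equivalence classes of arrow terms under the smallest equivalence relation that relates only terms of the same type, is a congruence for $\circ$, $\Box$ and $\Diamond$, and contains all instances of the following equations (for all modalities and all arrow terms $f : A \vdash B$ and composable $g,h$, with $M \in \{\Box, \Diamond\}$). Categorial and functorial equations: - $f \circ \mathbf{1}_A = \mathbf{1}_B \circ f = f$; - $h \circ (g \circ f) = (h \circ g) \circ f$; - $M\mathbf{1}_A = \mathbf{1}_{MA}$; - $M(g \circ f) = Mg \circ Mf$. Naturality equations: - $\varepsilon^\Box_B \circ \Box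 f = f \circ \varepsilon^\Box_A$; - $\Box\Box f \circ \delta^{\Box\Box}_A = \delta^{\Box\Box}_B \circ \Box f$; - $\Diamond f \circ \varepsilon^\Diamond_A = \varepsilon^\Diamond_B \circ f$; - $\delta^{\Diamond\Diamond}_B \circ \Diamond\Diamond f = \Diamond f \circ \delta^{\Diamond\Diamond}_A$. Comonad equations: - $\Box\delta^{\Box\Box}_A \circ \delta^{\Box\Box}_A = \delta^{\Box\Box}_{\Box A} \circ \delta^{\Box\Box}_A$; - $\varepsilon^\Box_{\Box A} \circ \delta^{\Box\Box}_A = \mathbf{1}_{\Box A}$; - $\Box\varepsilon^\Box_A \circ \delta^{\Box\Box}_A = \mathbf{1}_{\Box A}$. Monad equations: - $\delta^{\Diamond\Diamond}_A \circ \Diamond\delta^{\Diamond\Diamond}_A = \delta^{\Diamond\Diamond}_A \circ \delta^{\Diamond\Diamond}_{\Diamond A}$; - $\delta^{\Diamond\Diamond}_A \circ \varepsilon^\Diamond_{\Diamond A} = \mathbf{1}_{\Diamond A}$; - $\delta^{\Diamond\Diamond}_A \circ \Diamond\varepsilon^\Diamond_A = \mathbf{1}_{\Diamond A}$. $\mathit{Rel}$ is the category whose objects are the finite ordinals and whose arrows $n \to m$ are relations $R \subseteq n \times m$, with composition of relations. The functor $G : S4_{\Box\Diamond} \to \mathit{Rel}$ sends a modality $A$ to its length. Occurrences of letters in a modality of length $n$ are numbered $n-1, \dots, 0$ from left to right. For $A$ of length $n$: - $G\mathbf{1}_A$ is the identity relation; - $G\varepsilon^\Box_A = \{(i,i)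 : i < n\} \subseteq (n+1) \times n$; - $G\varepsilon^\Diamond_A = \{(i,i) : i < n\} \subseteq n \times (n+1)$; - $G\delta^{\Box\Box}_A = \{(i,i) : i < n\} \cup \{(n,n), (n,n+1)\} \subseteq (n+1) \times (n+2)$; - $G\delta^{\Diamond\Diamond}_A = \{(i,i) : i < n\} \cup \{(n,n), (n+1,n)\} \subseteq (n+2) \times (n+1)$; - $G(g \circ f) = Gg \circ Gf$; - for $f : A \vdash B$ with $A$ of length $n$ and $B$ of length $m$, $GMf = Gf \cup \{(n,m)\}$. -}

module Defs where

open import Data.Bool using (Bool; true; false; _∧_; _∨_)
open import Data.Nat using (ℕ; zero; suc; _≡ᵇ_)
open import Data.Fin using (Fin; zero; suc; toℕ)
open import Data.List using (List; []; _∷_; length)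
open import Data.Maybe using (Maybe; just; nothing)
import Data.Maybe as Maybe

data Letter : Set where
  □ ◇ : Letter

Modality : Set
Modality = List Letter

infixr 9 _∘ₜ_

data Term : Modality → Modality → Set where
  𝟏    : (A : Modality) → Term A A
  ε□   : (A : Modality) → Term (□ ∷ A) A
  ε◇   : (A : Modality) → Term A (◇ ∷ A)
  δ□□  : (A : Modality) → Term (□ ∷ A) (□ ∷ □ ∷ A)
  δ◇◇  : (A : Modality) → Term (◇ ∷ ◇ ∷ A) (◇ ∷ A)
  _∘ₜ_ : {A B C : Modality} → Term B C → Term A B → Term A C
  app  : (M : Letter) {A B : Modality} → Term A B → Term (M ∷ A) (M ∷ B)

infix 4 _≈_

data _≈_ : {A B : Modality} → Term A B → Term A B → Set where
  ≈-refl  : {A B : Modality} {f : Term A B} → f ≈ f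
  ≈-sym   : {A B : Modality} {f g : Term A B} → f ≈ g → g ≈ f
  ≈-trans : {A B : Modality} {f g h : Term A B} → f ≈ g → g ≈ h → f ≈ h
  ∘-cong  : {A B C : Modality} {f f' : Term A B} {g g' : Term B C} →
            f ≈ f' → g ≈ g' → g ∘ₜ f ≈ g' ∘ₜ f'
  app-cong : (M : Letter) {A B : Modality} {f f' : Term A B} →
            f ≈ f' → app M f ≈ app M f'
  idʳ     : {A B : Modality} (f : Term A B) → f ∘ₜ 𝟏 A ≈ f
  idˡ     : {A B : Modality} (f : Term A B) → 𝟏 B ∘ₜ f ≈ f
  assoc   : {A B C D : Modality} (f : Term A B) (g : Term B C) (h : Term C D) →
            h ∘ₜ (g ∘ₜ f) ≈ (h ∘ₜ g) ∘ₜ f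
  app-id  : (M : Letter) (A : Modality) → app M (𝟏 A) ≈ 𝟏 (M ∷ A)
  app-∘   : (M : Letter) {A B C : Modality} (f : Term A B) (g : Term B C) →
            app M (g ∘ₜ f) ≈ app M g ∘ₜ app M f
  nat-ε□  : {A B : Modality} (f : Term A B) → ε□ B ∘ₜ app □ f ≈ f ∘ₜ ε□ A
  nat-δ□□ : {A B : Modality} (f : Term A B) →
            app □ (app □ f) ∘ₜ δ□□ A ≈ δ□□ B ∘ₜ app □ f
  nat-ε◇  : {A B : Modality} (f : Term A B) → app ◇ f ∘ₜ ε◇ A ≈ ε◇ B ∘ₜ f
  nat-δ◇◇ : {A B : Modality} (f : Term A B) →
            δ◇◇ B ∘ₜ app ◇ (app ◇ f) ≈ app ◇ f ∘ₜ δ◇◇ A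
  □-assoc : (A : Modality) → app □ (δ□□ A) ∘ₜ δ□□ A ≈ δ□□ (□ ∷ A) ∘ₜ δ□□ A
  □-unit₁ : (A : Modality) → ε□ (□ ∷ A) ∘ₜ δ□□ A ≈ 𝟏 (□ ∷ A)
  □-unit₂ : (A : Modality) → app □ (ε□ A) ∘ₜ δ□□ A ≈ 𝟏 (□ ∷ A)
  ◇-assoc : (A : Modality) → δ◇◇ A ∘ₜ app ◇ (δ◇◇ A) ≈ δ◇◇ A ∘ₜ δ◇◇ (◇ ∷ A)
  ◇-unit₁ : (A : Modality) → δ◇◇ A ∘ₜ ε◇ (◇ ∷ A) ≈ 𝟏 (◇ ∷ A)
  ◇-unit₂ : (A : Modality) → δ◇◇ A ∘ₜ app ◇ (ε◇ A) ≈ 𝟏 (◇ ∷ A)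

RelArr : ℕ → ℕ → Set
RelArr n m = Fin n → Fin m → Bool

anyFin : (n : ℕ) → (Fin n → Bool) → Bool
anyFin zero    p = false
anyFin (suc n) p = p zero ∨ anyFin n (λ i → p (suc i))

_∘ᴿ_ : {n m k : ℕ} → RelArr m k → RelArr n m → RelArr n k
_∘ᴿ_ {m = m} S R i l = anyFin m (λ j → R i j ∧ S j l)

idᴿ : (n : ℕ) → RelArr n n
idᴿ n i j = toℕ i ≡ᵇ toℕ j

diagᴿ : {n m : ℕ} → RelArr n m
diagᴿ i j = toℕ i ≡ᵇ toℕ j

-- for i : Fin (suc n): nothing if i = n (the new top element), otherwise i as Fin n
unext : {n : ℕ} → Fin (suc n) → Maybe (Fin n)
unext {zero}  zero    = nothing
unext {suc n} zero    = just zero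
unext {suc n} (suc i) = Maybe.map suc (unext i)

-- G(Mf) = Gf ∪ {(n,m)}
extᴿ : {n m : ℕ} → RelArr n m → RelArr (suc n) (suc m)
extᴿ R i j with unext i | unext j
... | nothing | nothing = true
... | just a  | just b  = R a b
... | _       | _       = false

-- The functor G (on objects: length; letters of a modality of length n
-- numbered n-1,…,0 from left to right, so the prefixed letter is n)

G : {A B : Modality} → Term A B → RelArr (length A) (length B)
G (𝟏 A)     = idᴿ (length A)
G (ε□ A)    = diagᴿ
G (ε◇ A)    = diagᴿ
G (δ□□ A)   = λ i j → (toℕ i ≡ᵇ toℕ j) ∨ ((toℕ i ≡ᵇ length A) ∧ (toℕ j ≡ᵇ suc (length A)))
G (δ◇◇ A)   = λ i j → (toℕ i ≡ᵇ toℕ j) ∨ ((toℕ i ≡ᵇ suc (length A)) ∧ (toℕ j ≡ᵇ length A))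
G (g ∘ₜ f)  = G g ∘ᴿ G f
G (app M f) = extᴿ (G f)

-- Every arrow is equal to a normal form, in which the leftmost
-- letters of source and target are treated first: one of them is unlinked (an ε), they are
-- linked to each other, or the leftmost □ of the source (◇ of the target) is linked to two
-- letters (a δ). Composition of normal forms is sound for the equations by the Kleisli laws of
-- the comonad □ and the monad ◇, and for G by computing relational composition blockwise.
-- Conversely, the row and column of G f at the leftmost letters determine the outermost step of
-- the normal form, except that a link looks like a δ followed by an ε, and ε□ before ε◇ like ε◇
-- before ε□; in both cases the (co)unit laws identify the two normal forms.

module Submission where

open import Defs
open import Relation.Binary.PropositionalEquality using (_≡_)

open import Algebra.Bundles using (CommutativeMonoid)
open import Data.Bool using (Bool; true; false; _∧_; _∨_)
open import Data.Bool.Properties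
  using (∧-zeroʳ; ∧-identityʳ; ∧-comm; ∨-identityʳ; ∨-commutativeMonoid)
open import Data.Fin using (Fin; zero; suc; toℕ; fromℕ; inject₁)
open import Data.Fin.Properties using (toℕ-fromℕ; toℕ-inject₁; toℕ<n)
open import Data.Fin.Relation.Unary.Top using (view; ‵fromℕ; ‵inject₁)
open import Data.List using ([]; _∷_; length)
open import Data.Maybe using (just; nothing; maybe′)
open import Data.Nat using (ℕ; zero; suc; _≡ᵇ_)
open import Data.Nat.Properties using (<⇒≢; >⇒≢)
open import Data.Product using (Σ-syntax; _×_; _,_)
open import Function using (const)
open import Level using (0ℓ)
open import Relation.Binary.Bundles using (Setoid)
import Relation.Binary.Reasoning.Setoid as SetoidReasoning
open import Relation.Binary.PropositionalEquality
  using (_≢_; refl; sym; trans; cong; cong₂; module ≡-Reasoning)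
open import Relation.Nullary using (contradiction)

open import Algebra.Properties.CommutativeSemigroup
  (CommutativeMonoid.commutativeSemigroup ∨-commutativeMonoid)
  using (x∙yz≈y∙xz)

≡ᵇ-refl : ∀ n → (n ≡ᵇ n) ≡ true
≡ᵇ-refl zero    = refl
≡ᵇ-refl (suc n) = ≡ᵇ-refl n

≢⇒≡ᵇ-false : ∀ {m n} → m ≢ n → (m ≡ᵇ n) ≡ false
≢⇒≡ᵇ-false {zero}  {zero}  m≢n = contradiction refl m≢n
≢⇒≡ᵇ-false {zero}  {suc n} _   = refl
≢⇒≡ᵇ-false {suc m} {zero}  _   = refl
≢⇒≡ᵇ-false {suc m} {suc n} m≢n = ≢⇒≡ᵇ-false (λ m≡n → m≢n (cong suc m≡n))

-- Letters are numbered from the right, so the top index n of Fin (suc n) is the leftmost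
-- letter: the one a prefix adds.
isTop : ∀ {n} → Fin (suc n) → Bool
isTop {n} i = toℕ i ≡ᵇ n

isTop-fromℕ : ∀ n → isTop (fromℕ n) ≡ true
isTop-fromℕ n = trans (cong (_≡ᵇ n) (toℕ-fromℕ n)) (≡ᵇ-refl n)

isTop-inject₁ : ∀ {n} (i : Fin n) → isTop (inject₁ i) ≡ false
isTop-inject₁ {n} i = trans (cong (_≡ᵇ n) (toℕ-inject₁ i)) (≢⇒≡ᵇ-false (<⇒≢ (toℕ<n i)))

diagᴿ-refl : ∀ {n} (i : Fin n) → diagᴿ i i ≡ true
diagᴿ-refl i = ≡ᵇ-refl (toℕ i)

diagᴿ-inject₁ˡ : ∀ {n m} (i : Fin n) (j : Fin m) → diagᴿ (inject₁ i) j ≡ diagᴿ i j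
diagᴿ-inject₁ˡ i j = cong (_≡ᵇ toℕ j) (toℕ-inject₁ i)

diagᴿ-inject₁ʳ : ∀ {n m} (i : Fin n) (j : Fin m) → diagᴿ i (inject₁ j) ≡ diagᴿ i j
diagᴿ-inject₁ʳ i j = cong (toℕ i ≡ᵇ_) (toℕ-inject₁ j)

diagᴿ-fromℕˡ : ∀ {n} (j : Fin n) → diagᴿ (fromℕ n) j ≡ false
diagᴿ-fromℕˡ {n} j = trans (cong (_≡ᵇ toℕ j) (toℕ-fromℕ n)) (≢⇒≡ᵇ-false (>⇒≢ (toℕ<n j)))

diagᴿ-fromℕʳ : ∀ {n} (i : Fin n) → diagᴿ i (fromℕ n) ≡ false
diagᴿ-fromℕʳ {n} i = trans (cong (toℕ i ≡ᵇ_) (toℕ-fromℕ n)) (≢⇒≡ᵇ-false (<⇒≢ (toℕ<n i)))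

unext-fromℕ : ∀ n → unext (fromℕ n) ≡ nothing
unext-fromℕ zero                          = refl
unext-fromℕ (suc n) rewrite unext-fromℕ n = refl

unext-inject₁ : ∀ {n} (i : Fin n) → unext (inject₁ i) ≡ just i
unext-inject₁ {suc n} zero                            = refl
unext-inject₁ {suc n} (suc i) rewrite unext-inject₁ i = refl

anyFin-cong : ∀ m {p q : Fin m → Bool} → (∀ j → p j ≡ q j) → anyFin m p ≡ anyFin m q
anyFin-cong zero    p≡q = refl
anyFin-cong (suc m) p≡q = cong₂ _∨_ (p≡q zero) (anyFin-cong m (λ j → p≡q (suc j)))

anyFin-false : ∀ m {p : Fin m → Bool} → (∀ j → p j ≡ false) → anyFin m p ≡ false
anyFin-false zero    _       = refl
anyFin-false (suc m) p≡false = cong₂ _∨_ (p≡false zero) (anyFin-false m (λ j → p≡false (suc j)))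

anyFin-fromℕ : ∀ m (p : Fin (suc m) → Bool) →
               anyFin (suc m) p ≡ p (fromℕ m) ∨ anyFin m (λ j → p (inject₁ j))
anyFin-fromℕ zero    p = refl
anyFin-fromℕ (suc m) p =
  trans (cong (p zero ∨_) (anyFin-fromℕ m (λ j → p (suc j))))
    (x∙yz≈y∙xz (p zero) (p (suc (fromℕ m))) (anyFin m (λ j → p (suc (inject₁ j)))))

anyFin-isTopˡ : ∀ m (p : Fin (suc m) → Bool) → anyFin (suc m) (λ j → isTop j ∧ p j) ≡ p (fromℕ m)
anyFin-isTopˡ m p = begin
  anyFin (suc m) (λ j → isTop j ∧ p j)
    ≡⟨ anyFin-fromℕ m (λ j → isTop j ∧ p j) ⟩
  isTop (fromℕ m) ∧ p (fromℕ m) ∨ anyFin m (λ j → isTop (inject₁ j) ∧ p (inject₁ j))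
    ≡⟨ cong₂ _∨_ (cong (_∧ p (fromℕ m)) (isTop-fromℕ m))
                 (anyFin-false m (λ j → cong (_∧ p (inject₁ j)) (isTop-inject₁ j))) ⟩
  p (fromℕ m) ∨ false
    ≡⟨ ∨-identityʳ _ ⟩
  p (fromℕ m) ∎
  where open ≡-Reasoning

anyFin-isTopʳ : ∀ m (p : Fin (suc m) → Bool) → anyFin (suc m) (λ j → p j ∧ isTop j) ≡ p (fromℕ m)
anyFin-isTopʳ m p = trans (anyFin-cong (suc m) (λ j → ∧-comm (p j) (isTop j))) (anyFin-isTopˡ m p)

infix 4 _≐_

_≐_ : ∀ {n m} → RelArr n m → RelArr n m → Set
R ≐ S = ∀ i j → R i j ≡ S i j

≐-refl : ∀ {n m} {R : RelArr n m} → R ≐ R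
≐-refl i j = refl

≐-sym : ∀ {n m} {R S : RelArr n m} → R ≐ S → S ≐ R
≐-sym R≐S i j = sym (R≐S i j)

≐-trans : ∀ {n m} {R S T : RelArr n m} → R ≐ S → S ≐ T → R ≐ T
≐-trans R≐S S≐T i j = trans (R≐S i j) (S≐T i j)

≐-setoid : ℕ → ℕ → Setoid 0ℓ 0ℓ
≐-setoid n m = record
  { Carrier       = RelArr n m
  ; _≈_           = _≐_
  ; isEquivalence = record { refl = ≐-refl ; sym = ≐-sym ; trans = ≐-trans }
  }

module ≐-Reasoning {n m : ℕ} = SetoidReasoning (≐-setoid n m)

∘ᴿ-cong : ∀ {n m k} {S S' : RelArr m k} {R R' : RelArr n m} → S ≐ S' → R ≐ R' → S ∘ᴿ R ≐ S' ∘ᴿ R'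
∘ᴿ-cong {m = m} S≐S' R≐R' i l = anyFin-cong m (λ j → cong₂ _∧_ (R≐R' i j) (S≐S' j l))

∘ᴿ-congˡ : ∀ {n m k} {S S' : RelArr m k} (R : RelArr n m) → S ≐ S' → S ∘ᴿ R ≐ S' ∘ᴿ R
∘ᴿ-congˡ R S≐S' = ∘ᴿ-cong S≐S' (≐-refl {R = R})

∘ᴿ-congʳ : ∀ {n m k} (S : RelArr m k) {R R' : RelArr n m} → R ≐ R' → S ∘ᴿ R ≐ S ∘ᴿ R'
∘ᴿ-congʳ S R≐R' = ∘ᴿ-cong (≐-refl {R = S}) R≐R'

addColumn : ∀ {n m} → (Fin n → Bool) → RelArr n m → RelArr n (suc m)
addColumn c R i j = maybe′ (R i) (c i) (unext j)

addRow : ∀ {n m} → (Fin m → Bool) → RelArr n m → RelArr (suc n) m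
addRow r R i j = maybe′ (λ a → R a j) (r j) (unext i)

module _ {n m : ℕ} (c : Fin n → Bool) (R : RelArr n m) where

  addColumn-fromℕ : ∀ i → addColumn c R i (fromℕ m) ≡ c i
  addColumn-fromℕ i = cong (maybe′ (R i) (c i)) (unext-fromℕ m)

  addColumn-inject₁ : ∀ i j → addColumn c R i (inject₁ j) ≡ R i j
  addColumn-inject₁ i j = cong (maybe′ (R i) (c i)) (unext-inject₁ j)

module _ {n m : ℕ} (r : Fin m → Bool) (R : RelArr n m) where

  addRow-fromℕ : ∀ j → addRow r R (fromℕ n) j ≡ r j
  addRow-fromℕ j = cong (maybe′ (λ a → R a j) (r j)) (unext-fromℕ n)

  addRow-inject₁ : ∀ i j → addRow r R (inject₁ i) j ≡ R i j
  addRow-inject₁ i j = cong (maybe′ (λ a → R a j) (r j)) (unext-inject₁ i)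

addColumn-cong : ∀ {n m} {c c' : Fin n → Bool} {R R' : RelArr n m} →
                 (∀ i → c i ≡ c' i) → R ≐ R' → addColumn c R ≐ addColumn c' R'
addColumn-cong c≡c' R≐R' i j with unext j
... | nothing = c≡c' i
... | just b  = R≐R' i b

addRow-cong : ∀ {n m} {r r' : Fin m → Bool} {R R' : RelArr n m} →
              (∀ j → r j ≡ r' j) → R ≐ R' → addRow r R ≐ addRow r' R'
addRow-cong r≡r' R≐R' i j with unext i
... | nothing = r≡r' j
... | just a  = R≐R' a j

addColumn-congʳ : ∀ {n m} {c : Fin n → Bool} {R R' : RelArr n m} →
                  R ≐ R' → addColumn c R ≐ addColumn c R'
addColumn-congʳ = addColumn-cong (λ _ → refl)

addRow-congʳ : ∀ {n m} {r : Fin m → Bool} {R R' : RelArr n m} →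
               R ≐ R' → addRow r R ≐ addRow r R'
addRow-congʳ = addRow-cong (λ _ → refl)

addColumn-injective : ∀ {n m} {c c' : Fin n → Bool} {R R' : RelArr n m} →
                      addColumn c R ≐ addColumn c' R' → R ≐ R'
addColumn-injective {c = c} {c'} {R} {R'} eq i j =
  trans (sym (addColumn-inject₁ c R i j)) (trans (eq i (inject₁ j)) (addColumn-inject₁ c' R' i j))

addRow-injective : ∀ {n m} {r r' : Fin m → Bool} {R R' : RelArr n m} →
                   addRow r R ≐ addRow r' R' → R ≐ R'
addRow-injective {r = r} {r'} {R} {R'} eq i j =
  trans (sym (addRow-inject₁ r R i j)) (trans (eq (inject₁ i) j) (addRow-inject₁ r' R' i j))

module _ {n m : ℕ} (R : RelArr n m) where

  extᴿ-addRow : extᴿ R ≐ addRow isTop (addColumn (const false) R)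
  extᴿ-addRow i j with view i | view j
  ... | ‵fromℕ | ‵fromℕ rewrite unext-fromℕ n | unext-fromℕ m = sym (isTop-fromℕ m)
  ... | ‵fromℕ | ‵inject₁ j' rewrite unext-fromℕ n | unext-inject₁ j' = sym (isTop-inject₁ j')
  ... | ‵inject₁ i' | ‵fromℕ rewrite unext-inject₁ i' | unext-fromℕ m = refl
  ... | ‵inject₁ i' | ‵inject₁ j' rewrite unext-inject₁ i' | unext-inject₁ j' = refl

  extᴿ-addColumn : extᴿ R ≐ addColumn isTop (addRow (const false) R)
  extᴿ-addColumn i j with view i | view j
  ... | ‵fromℕ | ‵fromℕ rewrite unext-fromℕ n | unext-fromℕ m = sym (isTop-fromℕ n)
  ... | ‵fromℕ | ‵inject₁ j' rewrite unext-fromℕ n | unext-inject₁ j' = refl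
  ... | ‵inject₁ i' | ‵fromℕ rewrite unext-inject₁ i' | unext-fromℕ m = sym (isTop-inject₁ i')
  ... | ‵inject₁ i' | ‵inject₁ j' rewrite unext-inject₁ i' | unext-inject₁ j' = refl

  extᴿ-fromℕˡ : ∀ j → extᴿ R (fromℕ n) j ≡ isTop j
  extᴿ-fromℕˡ j =
    trans (extᴿ-addRow (fromℕ n) j) (addRow-fromℕ isTop (addColumn (const false) R) j)

  extᴿ-fromℕʳ : ∀ i → extᴿ R i (fromℕ m) ≡ isTop i
  extᴿ-fromℕʳ i =
    trans (extᴿ-addColumn i (fromℕ m)) (addColumn-fromℕ isTop (addRow (const false) R) i)

  extᴿ-inject₁ : ∀ i j → extᴿ R (inject₁ i) (inject₁ j) ≡ R i j
  extᴿ-inject₁ i j = trans (extᴿ-addRow (inject₁ i) (inject₁ j))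
    (trans (addRow-inject₁ isTop (addColumn (const false) R) i (inject₁ j))
           (addColumn-inject₁ (const false) R i j))

extᴿ-cong : ∀ {n m} {R R' : RelArr n m} → R ≐ R' → extᴿ R ≐ extᴿ R'
extᴿ-cong {R = R} {R'} R≐R' =
  ≐-trans (extᴿ-addRow R)
    (≐-trans (addRow-congʳ (addColumn-congʳ R≐R')) (≐-sym (extᴿ-addRow R')))

extᴿ-injective : ∀ {n m} {R R' : RelArr n m} → extᴿ R ≐ extᴿ R' → R ≐ R'
extᴿ-injective {R = R} {R'} eq =
  addColumn-injective
    (addRow-injective (≐-trans (≐-sym (extᴿ-addRow R)) (≐-trans eq (extᴿ-addRow R'))))

addColumn-∘ᴿ : ∀ {a b k} (c : Fin b → Bool) (S : RelArr b k) (R : RelArr a b) →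
               addColumn c S ∘ᴿ R ≐ addColumn (λ i → anyFin b (λ j → R i j ∧ c j)) (S ∘ᴿ R)
addColumn-∘ᴿ {b = b} c S R i l with view l
... | ‵fromℕ =
  trans (anyFin-cong b (λ j → cong (R i j ∧_) (addColumn-fromℕ c S j)))
        (sym (addColumn-fromℕ (λ i → anyFin b (λ j → R i j ∧ c j)) (S ∘ᴿ R) i))
... | ‵inject₁ l' =
  trans (anyFin-cong b (λ j → cong (R i j ∧_) (addColumn-inject₁ c S j l')))
        (sym (addColumn-inject₁ (λ i → anyFin b (λ j → R i j ∧ c j)) (S ∘ᴿ R) i l'))

∘ᴿ-addRow : ∀ {a b k} (r : Fin b → Bool) (S : RelArr b k) (R : RelArr a b) →
            S ∘ᴿ addRow r R ≐ addRow (λ l → anyFin b (λ j → r j ∧ S j l)) (S ∘ᴿ R)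
∘ᴿ-addRow {b = b} r S R i l with view i
... | ‵fromℕ =
  trans (anyFin-cong b (λ j → cong (_∧ S j l) (addRow-fromℕ r R j)))
        (sym (addRow-fromℕ (λ l → anyFin b (λ j → r j ∧ S j l)) (S ∘ᴿ R) l))
... | ‵inject₁ i' =
  trans (anyFin-cong b (λ j → cong (_∧ S j l) (addRow-inject₁ r R i' j)))
        (sym (addRow-inject₁ (λ l → anyFin b (λ j → r j ∧ S j l)) (S ∘ᴿ R) i' l))

addRow-∘ᴿ-addColumn : ∀ {a b k} (r : Fin k → Bool) (c : Fin a → Bool)
                      (S : RelArr b k) (R : RelArr a b) → (∀ i l → c i ∧ r l ≡ false) →
                      addRow r S ∘ᴿ addColumn c R ≐ S ∘ᴿ R
addRow-∘ᴿ-addColumn {b = b} r c S R disjoint i l =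
  trans (anyFin-fromℕ b (λ j → addColumn c R i j ∧ addRow r S j l))
    (cong₂ _∨_ (trans (cong₂ _∧_ (addColumn-fromℕ c R i) (addRow-fromℕ r S l)) (disjoint i l))
               (anyFin-cong b (λ j →
                  cong₂ _∧_ (addColumn-inject₁ c R i j) (addRow-inject₁ r S j l))))

addColumn-false-∘ᴿ : ∀ {a b k} (S : RelArr b k) (R : RelArr a b) →
                     addColumn (const false) S ∘ᴿ R ≐ addColumn (const false) (S ∘ᴿ R)
addColumn-false-∘ᴿ {b = b} S R = ≐-trans (addColumn-∘ᴿ (const false) S R)
  (addColumn-cong (λ i → anyFin-false b (λ j → ∧-zeroʳ (R i j))) ≐-refl)

∘ᴿ-addRow-false : ∀ {a b k} (S : RelArr b k) (R : RelArr a b) →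
                  S ∘ᴿ addRow (const false) R ≐ addRow (const false) (S ∘ᴿ R)
∘ᴿ-addRow-false {b = b} S R = ≐-trans (∘ᴿ-addRow (const false) S R)
  (addRow-cong (λ l → anyFin-false b (λ j → refl)) ≐-refl)

addColumn-isTop-∘ᴿ : ∀ {a b k} (S : RelArr (suc b) k) (R : RelArr a (suc b)) →
                     addColumn isTop S ∘ᴿ R ≐ addColumn (λ i → R i (fromℕ b)) (S ∘ᴿ R)
addColumn-isTop-∘ᴿ {b = b} S R = ≐-trans (addColumn-∘ᴿ isTop S R)
  (addColumn-cong (λ i → anyFin-isTopʳ b (R i)) ≐-refl)

∘ᴿ-addRow-isTop : ∀ {a b k} (S : RelArr (suc b) k) (R : RelArr a (suc b)) →
                  S ∘ᴿ addRow isTop R ≐ addRow (S (fromℕ b)) (S ∘ᴿ R)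
∘ᴿ-addRow-isTop {b = b} S R = ≐-trans (∘ᴿ-addRow isTop S R)
  (addRow-cong (λ l → anyFin-isTopˡ b (λ j → S j l)) ≐-refl)

extᴿ-∘ᴿ-addColumn : ∀ {a b k} (c : Fin a → Bool) (S : RelArr b k) (R : RelArr a b) →
                    extᴿ S ∘ᴿ addColumn c R ≐ addColumn c (S ∘ᴿ R)
extᴿ-∘ᴿ-addColumn {b = b} c S R = begin
  extᴿ S ∘ᴿ addColumn c R
    ≈⟨ ∘ᴿ-congˡ (addColumn c R) (extᴿ-addColumn S) ⟩
  addColumn isTop (addRow (const false) S) ∘ᴿ addColumn c R
    ≈⟨ addColumn-isTop-∘ᴿ (addRow (const false) S) (addColumn c R) ⟩
  addColumn (λ i → addColumn c R i (fromℕ b)) (addRow (const false) S ∘ᴿ addColumn c R)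
    ≈⟨ addColumn-cong (addColumn-fromℕ c R)
                      (addRow-∘ᴿ-addColumn (const false) c S R (λ i _ → ∧-zeroʳ (c i))) ⟩
  addColumn c (S ∘ᴿ R) ∎
  where open ≐-Reasoning

addRow-∘ᴿ-extᴿ : ∀ {a b k} (r : Fin k → Bool) (S : RelArr b k) (R : RelArr a b) →
                 addRow r S ∘ᴿ extᴿ R ≐ addRow r (S ∘ᴿ R)
addRow-∘ᴿ-extᴿ {b = b} r S R = begin
  addRow r S ∘ᴿ extᴿ R
    ≈⟨ ∘ᴿ-congʳ (addRow r S) (extᴿ-addRow R) ⟩
  addRow r S ∘ᴿ addRow isTop (addColumn (const false) R)
    ≈⟨ ∘ᴿ-addRow-isTop (addRow r S) (addColumn (const false) R) ⟩
  addRow (addRow r S (fromℕ b)) (addRow r S ∘ᴿ addColumn (const false) R)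
    ≈⟨ addRow-cong (addRow-fromℕ r S) (addRow-∘ᴿ-addColumn r (const false) S R (λ _ _ → refl)) ⟩
  addRow r (S ∘ᴿ R) ∎
  where open ≐-Reasoning

extᴿ-∘ᴿ-extᴿ : ∀ {a b k} (S : RelArr b k) (R : RelArr a b) → extᴿ S ∘ᴿ extᴿ R ≐ extᴿ (S ∘ᴿ R)
extᴿ-∘ᴿ-extᴿ S R = begin
  extᴿ S ∘ᴿ extᴿ R
    ≈⟨ ∘ᴿ-congʳ (extᴿ S) (extᴿ-addColumn R) ⟩
  extᴿ S ∘ᴿ addColumn isTop (addRow (const false) R)
    ≈⟨ extᴿ-∘ᴿ-addColumn isTop S (addRow (const false) R) ⟩
  addColumn isTop (S ∘ᴿ addRow (const false) R)
    ≈⟨ addColumn-congʳ (∘ᴿ-addRow-false S R) ⟩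
  addColumn isTop (addRow (const false) (S ∘ᴿ R))
    ≈⟨ extᴿ-addColumn (S ∘ᴿ R) ⟨
  extᴿ (S ∘ᴿ R) ∎
  where open ≐-Reasoning

extᴿ-idᴿ : ∀ n → extᴿ (idᴿ n) ≐ idᴿ (suc n)
extᴿ-idᴿ n i j with view i | view j
... | ‵fromℕ | ‵fromℕ =
  trans (extᴿ-fromℕˡ (idᴿ n) (fromℕ n)) (trans (isTop-fromℕ n) (sym (diagᴿ-refl (fromℕ n))))
... | ‵fromℕ | ‵inject₁ j' =
  trans (extᴿ-fromℕˡ (idᴿ n) (inject₁ j'))
    (trans (isTop-inject₁ j') (sym (trans (diagᴿ-inject₁ʳ (fromℕ n) j') (diagᴿ-fromℕˡ j'))))
... | ‵inject₁ i' | ‵fromℕ =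
  trans (extᴿ-fromℕʳ (idᴿ n) (inject₁ i'))
    (trans (isTop-inject₁ i') (sym (trans (diagᴿ-inject₁ˡ i' (fromℕ n)) (diagᴿ-fromℕʳ i'))))
... | ‵inject₁ i' | ‵inject₁ j' =
  trans (extᴿ-inject₁ (idᴿ n) i' j') (sym (trans (diagᴿ-inject₁ˡ i' _) (diagᴿ-inject₁ʳ i' j')))

diagᴿ-addRow : ∀ n → diagᴿ {suc n} {n} ≐ addRow (const false) (idᴿ n)
diagᴿ-addRow n i j with view i
... | ‵fromℕ      = trans (diagᴿ-fromℕˡ j) (sym (addRow-fromℕ (const false) (idᴿ n) j))
... | ‵inject₁ i' = trans (diagᴿ-inject₁ˡ i' j) (sym (addRow-inject₁ (const false) (idᴿ n) i' j))

diagᴿ-addColumn : ∀ n → diagᴿ {n} {suc n} ≐ addColumn (const false) (idᴿ n)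
diagᴿ-addColumn n i j with view j
... | ‵fromℕ      = trans (diagᴿ-fromℕʳ i) (sym (addColumn-fromℕ (const false) (idᴿ n) i))
... | ‵inject₁ j' = trans (diagᴿ-inject₁ʳ i j') (sym (addColumn-inject₁ (const false) (idᴿ n) i j'))

diagᴿ-∨-isTop-addColumn : ∀ n →
  (λ (i : Fin (suc n)) j → diagᴿ i j ∨ (isTop i ∧ isTop j)) ≐ addColumn isTop (idᴿ (suc n))
diagᴿ-∨-isTop-addColumn n i j with view j
... | ‵fromℕ = trans
  (cong₂ _∨_ (diagᴿ-fromℕʳ i) (trans (cong (isTop i ∧_) (isTop-fromℕ (suc n))) (∧-identityʳ _)))
  (sym (addColumn-fromℕ isTop (idᴿ (suc n)) i))
... | ‵inject₁ j' = trans
  (cong₂ _∨_ (diagᴿ-inject₁ʳ i j') (trans (cong (isTop i ∧_) (isTop-inject₁ j')) (∧-zeroʳ _)))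
  (trans (∨-identityʳ _) (sym (addColumn-inject₁ isTop (idᴿ (suc n)) i j')))

diagᴿ-∨-isTop-addRow : ∀ n →
  (λ i (j : Fin (suc n)) → diagᴿ i j ∨ (isTop i ∧ isTop j)) ≐ addRow isTop (idᴿ (suc n))
diagᴿ-∨-isTop-addRow n i j with view i
... | ‵fromℕ = trans
  (cong₂ _∨_ (diagᴿ-fromℕˡ j) (cong (_∧ isTop j) (isTop-fromℕ (suc n))))
  (sym (addRow-fromℕ isTop (idᴿ (suc n)) j))
... | ‵inject₁ i' = trans
  (cong₂ _∨_ (diagᴿ-inject₁ˡ i' j) (cong (_∧ isTop j) (isTop-inject₁ i')))
  (trans (∨-identityʳ _) (sym (addRow-inject₁ isTop (idᴿ (suc n)) i' j)))

≈-setoid : Modality → Modality → Setoid 0ℓ 0ℓ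
≈-setoid A B = record
  { Carrier       = Term A B
  ; _≈_           = _≈_
  ; isEquivalence = record { refl = ≈-refl ; sym = ≈-sym ; trans = ≈-trans }
  }

module ≈-Reasoning {A B : Modality} = SetoidReasoning (≈-setoid A B)

extend□ : ∀ {A B} → Term (□ ∷ A) B → Term (□ ∷ A) (□ ∷ B)
extend□ {A} f = app □ f ∘ₜ δ□□ A

extend◇ : ∀ {A B} → Term A (◇ ∷ B) → Term (◇ ∷ A) (◇ ∷ B)
extend◇ {B = B} f = δ◇◇ B ∘ₜ app ◇ f

extend□-cong : ∀ {A B} {f f' : Term (□ ∷ A) B} → f ≈ f' → extend□ f ≈ extend□ f'
extend□-cong f≈f' = ∘-cong ≈-refl (app-cong □ f≈f')

extend◇-cong : ∀ {A B} {f f' : Term A (◇ ∷ B)} → f ≈ f' → extend◇ f ≈ extend◇ f'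
extend◇-cong f≈f' = ∘-cong (app-cong ◇ f≈f') ≈-refl

module _ {A B : Modality} where
  open ≈-Reasoning

  ε□-∘-extend□ : (f : Term (□ ∷ A) B) → ε□ B ∘ₜ extend□ f ≈ f
  ε□-∘-extend□ f = begin
    ε□ B ∘ₜ (app □ f ∘ₜ δ□□ A)     ≈⟨ assoc _ _ _ ⟩
    (ε□ B ∘ₜ app □ f) ∘ₜ δ□□ A     ≈⟨ ∘-cong ≈-refl (nat-ε□ f) ⟩
    (f ∘ₜ ε□ (□ ∷ A)) ∘ₜ δ□□ A     ≈⟨ assoc _ _ _ ⟨
    f ∘ₜ (ε□ (□ ∷ A) ∘ₜ δ□□ A)     ≈⟨ ∘-cong (□-unit₁ A) ≈-refl ⟩
    f ∘ₜ 𝟏 (□ ∷ A)                 ≈⟨ idʳ f ⟩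
    f                              ∎

  extend□-∘ε□ : (f : Term A B) → extend□ (f ∘ₜ ε□ A) ≈ app □ f
  extend□-∘ε□ f = begin
    app □ (f ∘ₜ ε□ A) ∘ₜ δ□□ A             ≈⟨ ∘-cong ≈-refl (app-∘ □ _ _) ⟩
    (app □ f ∘ₜ app □ (ε□ A)) ∘ₜ δ□□ A     ≈⟨ assoc _ _ _ ⟨
    app □ f ∘ₜ (app □ (ε□ A) ∘ₜ δ□□ A)     ≈⟨ ∘-cong (□-unit₂ A) ≈-refl ⟩
    app □ f ∘ₜ 𝟏 (□ ∷ A)                   ≈⟨ idʳ _ ⟩
    app □ f                                ∎

  extend◇-∘-ε◇ : (f : Term A (◇ ∷ B)) → extend◇ f ∘ₜ ε◇ A ≈ f
  extend◇-∘-ε◇ f = begin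
    (δ◇◇ B ∘ₜ app ◇ f) ∘ₜ ε◇ A     ≈⟨ assoc _ _ _ ⟨
    δ◇◇ B ∘ₜ (app ◇ f ∘ₜ ε◇ A)     ≈⟨ ∘-cong (nat-ε◇ f) ≈-refl ⟩
    δ◇◇ B ∘ₜ (ε◇ (◇ ∷ B) ∘ₜ f)     ≈⟨ assoc _ _ _ ⟩
    (δ◇◇ B ∘ₜ ε◇ (◇ ∷ B)) ∘ₜ f     ≈⟨ ∘-cong ≈-refl (◇-unit₁ B) ⟩
    𝟏 (◇ ∷ B) ∘ₜ f                 ≈⟨ idˡ f ⟩
    f                              ∎

  extend◇-ε◇∘ : (f : Term A B) → extend◇ (ε◇ B ∘ₜ f) ≈ app ◇ f
  extend◇-ε◇∘ f = begin
    δ◇◇ B ∘ₜ app ◇ (ε◇ B ∘ₜ f)             ≈⟨ ∘-cong (app-∘ ◇ _ _) ≈-refl ⟩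
    δ◇◇ B ∘ₜ (app ◇ (ε◇ B) ∘ₜ app ◇ f)     ≈⟨ assoc _ _ _ ⟩
    (δ◇◇ B ∘ₜ app ◇ (ε◇ B)) ∘ₜ app ◇ f     ≈⟨ ∘-cong ≈-refl (◇-unit₂ B) ⟩
    𝟏 (◇ ∷ B) ∘ₜ app ◇ f                   ≈⟨ idˡ _ ⟩
    app ◇ f                                ∎

app□-∘-extend□ : ∀ {A B C} (g : Term B C) (f : Term (□ ∷ A) B) →
                 app □ g ∘ₜ extend□ f ≈ extend□ (g ∘ₜ f)
app□-∘-extend□ {A} g f = begin
  app □ g ∘ₜ (app □ f ∘ₜ δ□□ A)     ≈⟨ assoc _ _ _ ⟩
  (app □ g ∘ₜ app □ f) ∘ₜ δ□□ A     ≈⟨ ∘-cong ≈-refl (app-∘ □ f g) ⟨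
  app □ (g ∘ₜ f) ∘ₜ δ□□ A           ∎
  where open ≈-Reasoning

extend□-∘-app□ : ∀ {A B C} (g : Term (□ ∷ B) C) (f : Term A B) →
                 extend□ g ∘ₜ app □ f ≈ extend□ (g ∘ₜ app □ f)
extend□-∘-app□ {A} {B} g f = begin
  (app □ g ∘ₜ δ□□ B) ∘ₜ app □ f             ≈⟨ assoc _ _ _ ⟨
  app □ g ∘ₜ (δ□□ B ∘ₜ app □ f)             ≈⟨ ∘-cong (nat-δ□□ f) ≈-refl ⟨
  app □ g ∘ₜ (app □ (app □ f) ∘ₜ δ□□ A)     ≈⟨ app□-∘-extend□ g (app □ f) ⟩
  app □ (g ∘ₜ app □ f) ∘ₜ δ□□ A             ∎
  where open ≈-Reasoning

extend□-∘-extend□ : ∀ {A B C} (g : Term (□ ∷ B) C) (f : Term (□ ∷ A) B) →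
                    extend□ g ∘ₜ extend□ f ≈ extend□ (g ∘ₜ extend□ f)
extend□-∘-extend□ {A} g f = begin
  extend□ g ∘ₜ (app □ f ∘ₜ δ□□ A)                     ≈⟨ assoc _ _ _ ⟩
  (extend□ g ∘ₜ app □ f) ∘ₜ δ□□ A                     ≈⟨ ∘-cong ≈-refl (extend□-∘-app□ g f) ⟩
  (app □ (g ∘ₜ app □ f) ∘ₜ δ□□ (□ ∷ A)) ∘ₜ δ□□ A      ≈⟨ assoc _ _ _ ⟨
  app □ (g ∘ₜ app □ f) ∘ₜ (δ□□ (□ ∷ A) ∘ₜ δ□□ A)      ≈⟨ ∘-cong (□-assoc A) ≈-refl ⟨
  app □ (g ∘ₜ app □ f) ∘ₜ (app □ (δ□□ A) ∘ₜ δ□□ A)    ≈⟨ app□-∘-extend□ (g ∘ₜ app □ f) (δ□□ A) ⟩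
  app □ ((g ∘ₜ app □ f) ∘ₜ δ□□ A) ∘ₜ δ□□ A            ≈⟨ extend□-cong (assoc _ _ _) ⟨
  app □ (g ∘ₜ (app □ f ∘ₜ δ□□ A)) ∘ₜ δ□□ A            ∎
  where open ≈-Reasoning

extend◇-∘-app◇ : ∀ {A B C} (g : Term B (◇ ∷ C)) (f : Term A B) →
                 extend◇ g ∘ₜ app ◇ f ≈ extend◇ (g ∘ₜ f)
extend◇-∘-app◇ {C = C} g f = begin
  (δ◇◇ C ∘ₜ app ◇ g) ∘ₜ app ◇ f     ≈⟨ assoc _ _ _ ⟨
  δ◇◇ C ∘ₜ (app ◇ g ∘ₜ app ◇ f)     ≈⟨ ∘-cong (app-∘ ◇ f g) ≈-refl ⟨
  δ◇◇ C ∘ₜ app ◇ (g ∘ₜ f)           ∎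
  where open ≈-Reasoning

app◇-∘-extend◇ : ∀ {A B C} (g : Term B C) (f : Term A (◇ ∷ B)) →
                 app ◇ g ∘ₜ extend◇ f ≈ extend◇ (app ◇ g ∘ₜ f)
app◇-∘-extend◇ {B = B} {C} g f = begin
  app ◇ g ∘ₜ (δ◇◇ B ∘ₜ app ◇ f)             ≈⟨ assoc _ _ _ ⟩
  (app ◇ g ∘ₜ δ◇◇ B) ∘ₜ app ◇ f             ≈⟨ ∘-cong ≈-refl (nat-δ◇◇ g) ⟨
  (δ◇◇ C ∘ₜ app ◇ (app ◇ g)) ∘ₜ app ◇ f     ≈⟨ extend◇-∘-app◇ (app ◇ g) f ⟩
  δ◇◇ C ∘ₜ app ◇ (app ◇ g ∘ₜ f)             ∎
  where open ≈-Reasoning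

extend◇-∘-extend◇ : ∀ {A B C} (g : Term B (◇ ∷ C)) (f : Term A (◇ ∷ B)) →
                    extend◇ g ∘ₜ extend◇ f ≈ extend◇ (extend◇ g ∘ₜ f)
extend◇-∘-extend◇ {C = C} g f = begin
  (δ◇◇ C ∘ₜ app ◇ g) ∘ₜ extend◇ f                     ≈⟨ assoc _ _ _ ⟨
  δ◇◇ C ∘ₜ (app ◇ g ∘ₜ extend◇ f)                     ≈⟨ ∘-cong (app◇-∘-extend◇ g f) ≈-refl ⟩
  δ◇◇ C ∘ₜ (δ◇◇ (◇ ∷ C) ∘ₜ app ◇ (app ◇ g ∘ₜ f))      ≈⟨ assoc _ _ _ ⟩
  (δ◇◇ C ∘ₜ δ◇◇ (◇ ∷ C)) ∘ₜ app ◇ (app ◇ g ∘ₜ f)      ≈⟨ ∘-cong ≈-refl (◇-assoc C) ⟨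
  (δ◇◇ C ∘ₜ app ◇ (δ◇◇ C)) ∘ₜ app ◇ (app ◇ g ∘ₜ f)    ≈⟨ extend◇-∘-app◇ (δ◇◇ C) (app ◇ g ∘ₜ f) ⟩
  δ◇◇ C ∘ₜ app ◇ (δ◇◇ C ∘ₜ (app ◇ g ∘ₜ f))            ≈⟨ extend◇-cong (assoc _ _ _) ⟩
  δ◇◇ C ∘ₜ app ◇ ((δ◇◇ C ∘ₜ app ◇ g) ∘ₜ f)            ∎
  where open ≈-Reasoning

-- ins/del: unlinked leftmost target/source letter; lnk: linked leftmost letters;
-- dup/mrg: the leftmost source □ (target ◇) is also linked to a new leftmost target □ (source ◇).
data NF : Modality → Modality → Set where
  nil : NF [] []
  ins : ∀ {A B} → NF A B → NF A (◇ ∷ B)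
  del : ∀ {A B} → NF A B → NF (□ ∷ A) B
  lnk : ∀ M {A B} → NF A B → NF (M ∷ A) (M ∷ B)
  dup : ∀ {A B} → NF (□ ∷ A) B → NF (□ ∷ A) (□ ∷ B)
  mrg : ∀ {A B} → NF A (◇ ∷ B) → NF (◇ ∷ A) (◇ ∷ B)

emb : ∀ {A B} → NF A B → Term A B
emb nil             = 𝟏 []
emb (ins {B = B} x) = ε◇ B ∘ₜ emb x
emb (del {A} x)     = emb x ∘ₜ ε□ A
emb (lnk M x)       = app M (emb x)
emb (dup x)         = extend□ (emb x)
emb (mrg x)         = extend◇ (emb x)

Sem : ∀ {A B} → NF A B → RelArr (length A) (length B)
Sem nil       = λ ()
Sem (ins x)   = addColumn (const false) (Sem x)
Sem (del x)   = addRow (const false) (Sem x)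
Sem (lnk M x) = extᴿ (Sem x)
Sem (dup x)   = addColumn isTop (Sem x)
Sem (mrg x)   = addRow isTop (Sem x)

infixr 9 _∘ₙ_

_∘ₙ_ : ∀ {A B C} → NF B C → NF A B → NF A C
ins g     ∘ₙ f         = ins (g ∘ₙ f)
nil       ∘ₙ nil       = nil
nil       ∘ₙ del f     = del (nil ∘ₙ f)
del g     ∘ₙ del f     = del (del g ∘ₙ f)
del g     ∘ₙ lnk □ f   = del (g ∘ₙ f)
del g     ∘ₙ dup f     = g ∘ₙ f
lnk M g   ∘ₙ del f     = del (lnk M g ∘ₙ f)
lnk M g   ∘ₙ lnk .M f  = lnk M (g ∘ₙ f)
lnk □ g   ∘ₙ dup f     = dup (g ∘ₙ f)
lnk ◇ g   ∘ₙ mrg f     = mrg (lnk ◇ g ∘ₙ f)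
lnk ◇ g   ∘ₙ ins f     = ins (g ∘ₙ f)
dup g     ∘ₙ del f     = del (dup g ∘ₙ f)
dup g     ∘ₙ lnk □ f   = dup (g ∘ₙ lnk □ f)
dup g     ∘ₙ dup f     = dup (g ∘ₙ dup f)
mrg g     ∘ₙ del f     = del (mrg g ∘ₙ f)
mrg g     ∘ₙ lnk ◇ f   = mrg (g ∘ₙ f)
mrg g     ∘ₙ ins f     = g ∘ₙ f
mrg g     ∘ₙ mrg f     = mrg (mrg g ∘ₙ f)

emb-∘ₙ : ∀ {A B C} (g : NF B C) (f : NF A B) → emb (g ∘ₙ f) ≈ emb g ∘ₜ emb f
emb-∘ₙ (ins g) f = ≈-trans (∘-cong (emb-∘ₙ g f) ≈-refl) (assoc _ _ _)
emb-∘ₙ nil nil = ≈-sym (idˡ _)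
emb-∘ₙ nil (del f) = ≈-trans (∘-cong ≈-refl (emb-∘ₙ nil f)) (≈-sym (assoc _ _ _))
emb-∘ₙ (del g) (del f) = ≈-trans (∘-cong ≈-refl (emb-∘ₙ (del g) f)) (≈-sym (assoc _ _ _))
emb-∘ₙ (del {B} g) (lnk □ f) = begin
  emb (g ∘ₙ f) ∘ₜ ε□ _             ≈⟨ ∘-cong ≈-refl (emb-∘ₙ g f) ⟩
  (emb g ∘ₜ emb f) ∘ₜ ε□ _         ≈⟨ assoc _ _ _ ⟨
  emb g ∘ₜ (emb f ∘ₜ ε□ _)         ≈⟨ ∘-cong (nat-ε□ (emb f)) ≈-refl ⟨
  emb g ∘ₜ (ε□ B ∘ₜ app □ (emb f)) ≈⟨ assoc _ _ _ ⟩
  (emb g ∘ₜ ε□ B) ∘ₜ app □ (emb f) ∎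
  where open ≈-Reasoning
emb-∘ₙ (del {B} g) (dup f) = begin
  emb (g ∘ₙ f)                         ≈⟨ emb-∘ₙ g f ⟩
  emb g ∘ₜ emb f                       ≈⟨ ∘-cong (ε□-∘-extend□ (emb f)) ≈-refl ⟨
  emb g ∘ₜ (ε□ B ∘ₜ extend□ (emb f))   ≈⟨ assoc _ _ _ ⟩
  (emb g ∘ₜ ε□ B) ∘ₜ extend□ (emb f)   ∎
  where open ≈-Reasoning
emb-∘ₙ (lnk M g) (del f) = ≈-trans (∘-cong ≈-refl (emb-∘ₙ (lnk M g) f)) (≈-sym (assoc _ _ _))
emb-∘ₙ (lnk M g) (lnk .M f) = ≈-trans (app-cong M (emb-∘ₙ g f)) (app-∘ M (emb f) (emb g))
emb-∘ₙ (lnk □ g) (dup f) =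
  ≈-trans (extend□-cong (emb-∘ₙ g f)) (≈-sym (app□-∘-extend□ (emb g) (emb f)))
emb-∘ₙ (lnk ◇ g) (mrg f) =
  ≈-trans (extend◇-cong (emb-∘ₙ (lnk ◇ g) f)) (≈-sym (app◇-∘-extend◇ (emb g) (emb f)))
emb-∘ₙ (lnk ◇ {B} {C} g) (ins f) = begin
  ε◇ C ∘ₜ emb (g ∘ₙ f)                 ≈⟨ ∘-cong (emb-∘ₙ g f) ≈-refl ⟩
  ε◇ C ∘ₜ (emb g ∘ₜ emb f)             ≈⟨ assoc _ _ _ ⟩
  (ε◇ C ∘ₜ emb g) ∘ₜ emb f             ≈⟨ ∘-cong ≈-refl (nat-ε◇ (emb g)) ⟨
  (app ◇ (emb g) ∘ₜ ε◇ B) ∘ₜ emb f     ≈⟨ assoc _ _ _ ⟨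
  app ◇ (emb g) ∘ₜ (ε◇ B ∘ₜ emb f)     ∎
  where open ≈-Reasoning
emb-∘ₙ (dup g) (del f) = ≈-trans (∘-cong ≈-refl (emb-∘ₙ (dup g) f)) (≈-sym (assoc _ _ _))
emb-∘ₙ (dup g) (lnk □ f) =
  ≈-trans (extend□-cong (emb-∘ₙ g (lnk □ f))) (≈-sym (extend□-∘-app□ (emb g) (emb f)))
emb-∘ₙ (dup g) (dup f) =
  ≈-trans (extend□-cong (emb-∘ₙ g (dup f))) (≈-sym (extend□-∘-extend□ (emb g) (emb f)))
emb-∘ₙ (mrg g) (del f) = ≈-trans (∘-cong ≈-refl (emb-∘ₙ (mrg g) f)) (≈-sym (assoc _ _ _))
emb-∘ₙ (mrg g) (lnk ◇ f) =
  ≈-trans (extend◇-cong (emb-∘ₙ g f)) (≈-sym (extend◇-∘-app◇ (emb g) (emb f)))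
emb-∘ₙ (mrg g) (ins {B = B} f) = begin
  emb (g ∘ₙ f)                         ≈⟨ emb-∘ₙ g f ⟩
  emb g ∘ₜ emb f                       ≈⟨ ∘-cong ≈-refl (extend◇-∘-ε◇ (emb g)) ⟨
  (extend◇ (emb g) ∘ₜ ε◇ B) ∘ₜ emb f   ≈⟨ assoc _ _ _ ⟨
  extend◇ (emb g) ∘ₜ (ε◇ B ∘ₜ emb f)   ∎
  where open ≈-Reasoning
emb-∘ₙ (mrg g) (mrg f) =
  ≈-trans (extend◇-cong (emb-∘ₙ (mrg g) f)) (≈-sym (extend◇-∘-extend◇ (emb g) (emb f)))

Sem-∘ₙ : ∀ {A B C} (g : NF B C) (f : NF A B) → Sem (g ∘ₙ f) ≐ Sem g ∘ᴿ Sem f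
Sem-∘ₙ (ins g) f = ≐-trans (addColumn-congʳ (Sem-∘ₙ g f))
  (≐-sym (addColumn-false-∘ᴿ (Sem g) (Sem f)))
Sem-∘ₙ nil nil = λ ()
Sem-∘ₙ nil (del f) = ≐-trans (addRow-congʳ (Sem-∘ₙ nil f))
  (≐-sym (∘ᴿ-addRow-false (Sem nil) (Sem f)))
Sem-∘ₙ (del g) (del f) = ≐-trans (addRow-congʳ (Sem-∘ₙ (del g) f))
  (≐-sym (∘ᴿ-addRow-false (Sem (del g)) (Sem f)))
Sem-∘ₙ (del g) (lnk □ f) = ≐-trans (addRow-congʳ (Sem-∘ₙ g f))
  (≐-sym (addRow-∘ᴿ-extᴿ (const false) (Sem g) (Sem f)))
Sem-∘ₙ (del g) (dup f) = ≐-trans (Sem-∘ₙ g f)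
  (≐-sym (addRow-∘ᴿ-addColumn (const false) isTop (Sem g) (Sem f) (λ i _ → ∧-zeroʳ (isTop i))))
Sem-∘ₙ (lnk M g) (del f) = ≐-trans (addRow-congʳ (Sem-∘ₙ (lnk M g) f))
  (≐-sym (∘ᴿ-addRow-false (Sem (lnk M g)) (Sem f)))
Sem-∘ₙ (lnk M g) (lnk .M f) = ≐-trans (extᴿ-cong (Sem-∘ₙ g f))
  (≐-sym (extᴿ-∘ᴿ-extᴿ (Sem g) (Sem f)))
Sem-∘ₙ (lnk □ g) (dup f) = ≐-trans (addColumn-congʳ (Sem-∘ₙ g f))
  (≐-sym (extᴿ-∘ᴿ-addColumn isTop (Sem g) (Sem f)))
Sem-∘ₙ (lnk ◇ g) (mrg f) = ≐-trans (addRow-congʳ (Sem-∘ₙ (lnk ◇ g) f))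
  (≐-sym (≐-trans (∘ᴿ-addRow-isTop (Sem (lnk ◇ g)) (Sem f))
                  (addRow-cong (extᴿ-fromℕˡ (Sem g)) ≐-refl)))
Sem-∘ₙ (lnk ◇ g) (ins f) = ≐-trans (addColumn-congʳ (Sem-∘ₙ g f))
  (≐-sym (extᴿ-∘ᴿ-addColumn (const false) (Sem g) (Sem f)))
Sem-∘ₙ (dup g) (del f) = ≐-trans (addRow-congʳ (Sem-∘ₙ (dup g) f))
  (≐-sym (∘ᴿ-addRow-false (Sem (dup g)) (Sem f)))
Sem-∘ₙ (dup g) (lnk □ f) = ≐-trans (addColumn-congʳ (Sem-∘ₙ g (lnk □ f)))
  (≐-sym (≐-trans (addColumn-isTop-∘ᴿ (Sem g) (Sem (lnk □ f)))
                  (addColumn-cong (extᴿ-fromℕʳ (Sem f)) ≐-refl)))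
Sem-∘ₙ (dup g) (dup f) = ≐-trans (addColumn-congʳ (Sem-∘ₙ g (dup f)))
  (≐-sym (≐-trans (addColumn-isTop-∘ᴿ (Sem g) (Sem (dup f)))
                  (addColumn-cong (addColumn-fromℕ isTop (Sem f)) ≐-refl)))
Sem-∘ₙ (mrg g) (del f) = ≐-trans (addRow-congʳ (Sem-∘ₙ (mrg g) f))
  (≐-sym (∘ᴿ-addRow-false (Sem (mrg g)) (Sem f)))
Sem-∘ₙ (mrg g) (lnk ◇ f) = ≐-trans (addRow-congʳ (Sem-∘ₙ g f))
  (≐-sym (addRow-∘ᴿ-extᴿ isTop (Sem g) (Sem f)))
Sem-∘ₙ (mrg g) (ins f) = ≐-trans (Sem-∘ₙ g f)
  (≐-sym (addRow-∘ᴿ-addColumn isTop (const false) (Sem g) (Sem f) (λ _ _ → refl)))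
Sem-∘ₙ (mrg g) (mrg f) = ≐-trans (addRow-congʳ (Sem-∘ₙ (mrg g) f))
  (≐-sym (≐-trans (∘ᴿ-addRow-isTop (Sem (mrg g)) (Sem f))
                  (addRow-cong (addRow-fromℕ isTop (Sem g)) ≐-refl)))

idN : ∀ A → NF A A
idN []      = nil
idN (M ∷ A) = lnk M (idN A)

norm : ∀ {A B} → Term A B → NF A B
norm (𝟏 A)     = idN A
norm (ε□ A)    = del (idN A)
norm (ε◇ A)    = ins (idN A)
norm (δ□□ A)   = dup (lnk □ (idN A))
norm (δ◇◇ A)   = mrg (lnk ◇ (idN A))
norm (g ∘ₜ f)  = norm g ∘ₙ norm f
norm (app M f) = lnk M (norm f)

emb-idN : ∀ A → emb (idN A) ≈ 𝟏 A
emb-idN []      = ≈-refl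
emb-idN (M ∷ A) = ≈-trans (app-cong M (emb-idN A)) (app-id M A)

norm-sound : ∀ {A B} (f : Term A B) → f ≈ emb (norm f)
norm-sound (𝟏 A)     = ≈-sym (emb-idN A)
norm-sound (ε□ A)    = ≈-sym (≈-trans (∘-cong ≈-refl (emb-idN A)) (idˡ _))
norm-sound (ε◇ A)    = ≈-sym (≈-trans (∘-cong (emb-idN A) ≈-refl) (idʳ _))
norm-sound (δ□□ A)   = ≈-sym (≈-trans (∘-cong ≈-refl (emb-idN (□ ∷ □ ∷ A))) (idˡ _))
norm-sound (δ◇◇ A)   = ≈-sym (≈-trans (∘-cong (emb-idN (◇ ∷ ◇ ∷ A)) ≈-refl) (idʳ _))
norm-sound (g ∘ₜ f)  =
  ≈-trans (∘-cong (norm-sound f) (norm-sound g)) (≈-sym (emb-∘ₙ (norm g) (norm f)))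
norm-sound (app M f) = app-cong M (norm-sound f)

Sem-idN : ∀ A → Sem (idN A) ≐ idᴿ (length A)
Sem-idN []      = λ ()
Sem-idN (M ∷ A) = ≐-trans (extᴿ-cong (Sem-idN A)) (extᴿ-idᴿ (length A))

G-norm : ∀ {A B} (f : Term A B) → G f ≐ Sem (norm f)
G-norm (𝟏 A)     = ≐-sym (Sem-idN A)
G-norm (ε□ A)    = ≐-trans (diagᴿ-addRow (length A)) (addRow-congʳ (≐-sym (Sem-idN A)))
G-norm (ε◇ A)    = ≐-trans (diagᴿ-addColumn (length A)) (addColumn-congʳ (≐-sym (Sem-idN A)))
G-norm (δ□□ A)   = ≐-trans (diagᴿ-∨-isTop-addColumn (length A))
                           (addColumn-congʳ (≐-sym (Sem-idN (□ ∷ A))))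
G-norm (δ◇◇ A)   = ≐-trans (diagᴿ-∨-isTop-addRow (length A))
                           (addRow-congʳ (≐-sym (Sem-idN (◇ ∷ A))))
G-norm (g ∘ₜ f)  = ≐-trans (∘ᴿ-cong (G-norm g) (G-norm f)) (≐-sym (Sem-∘ₙ (norm g) (norm f)))
G-norm (app M f) = extᴿ-cong (G-norm f)

linksTops : ∀ {M N A B} → NF (M ∷ A) (N ∷ B) → Bool
linksTops (ins _)   = false
linksTops (del _)   = false
linksTops (lnk _ _) = true
linksTops (dup _)   = true
linksTops (mrg _)   = true

Sem-fromℕ : ∀ {M N A B} (x : NF (M ∷ A) (N ∷ B)) →
            Sem x (fromℕ (length A)) (fromℕ (length B)) ≡ linksTops x
Sem-fromℕ (ins x)   = addColumn-fromℕ (const false) (Sem x) _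
Sem-fromℕ (del x)   = addRow-fromℕ (const false) (Sem x) _
Sem-fromℕ {B = B} (lnk M x) = trans (extᴿ-fromℕˡ (Sem x) _) (isTop-fromℕ (length B))
Sem-fromℕ {A = A} (dup x)   = trans (addColumn-fromℕ isTop (Sem x) _) (isTop-fromℕ (length A))
Sem-fromℕ {B = B} (mrg x)   = trans (addRow-fromℕ isTop (Sem x) _) (isTop-fromℕ (length B))

linksTops-cong : ∀ {M N A B} (x y : NF (M ∷ A) (N ∷ B)) →
                 Sem x ≐ Sem y → linksTops x ≡ linksTops y
linksTops-cong x y Sx≐Sy = trans (sym (Sem-fromℕ x)) (trans (Sx≐Sy _ _) (Sem-fromℕ y))

dropTopRow : ∀ {n m} → RelArr (suc n) m → RelArr n m
dropTopRow R i = R (inject₁ i)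

dropTopColumn : ∀ {n m} → RelArr n (suc m) → RelArr n m
dropTopColumn R i j = R i (inject₁ j)

emptyTopRow⇒del : ∀ {A B} (x : NF (□ ∷ A) B) → (∀ j → Sem x (fromℕ (length A)) j ≡ false) →
                  Σ[ x' ∈ NF A B ] (emb x ≈ emb (del x')) × (Sem x' ≐ dropTopRow (Sem x))
emptyTopRow⇒del (del x) empty =
  x , ≈-refl , λ i j → sym (addRow-inject₁ (const false) (Sem x) i j)
emptyTopRow⇒del (lnk □ x) empty =
  contradiction (trans (sym (Sem-fromℕ (lnk □ x))) (empty _)) λ ()
emptyTopRow⇒del (dup x) empty =
  contradiction (trans (sym (Sem-fromℕ (dup x))) (empty _)) λ ()
emptyTopRow⇒del (ins x) empty
  with x' , x≈ , Sx'≐ ← emptyTopRow⇒del x (λ j →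
         trans (sym (addColumn-inject₁ (const false) (Sem x) _ j)) (empty (inject₁ j)))
  = ins x' , ≈-trans (∘-cong x≈ ≈-refl) (assoc _ _ _) , addColumn-congʳ Sx'≐

emptyTopColumn⇒ins : ∀ {A B} (x : NF A (◇ ∷ B)) → (∀ i → Sem x i (fromℕ (length B)) ≡ false) →
                     Σ[ x' ∈ NF A B ] (emb x ≈ emb (ins x')) × (Sem x' ≐ dropTopColumn (Sem x))
emptyTopColumn⇒ins (ins x) empty =
  x , ≈-refl , λ i j → sym (addColumn-inject₁ (const false) (Sem x) i j)
emptyTopColumn⇒ins (lnk ◇ x) empty =
  contradiction (trans (sym (Sem-fromℕ (lnk ◇ x))) (empty _)) λ ()
emptyTopColumn⇒ins (mrg x) empty =
  contradiction (trans (sym (Sem-fromℕ (mrg x))) (empty _)) λ ()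
emptyTopColumn⇒ins (del x) empty
  with x' , x≈ , Sx'≐ ← emptyTopColumn⇒ins x (λ i →
         trans (sym (addRow-inject₁ (const false) (Sem x) i _)) (empty (inject₁ i)))
  = del x' , ≈-trans (∘-cong ≈-refl x≈) (≈-sym (assoc _ _ _)) , addRow-congʳ Sx'≐

SemInjective : Modality → Modality → Set
SemInjective A B = (x y : NF A B) → Sem x ≐ Sem y → emb x ≈ emb y

lnk□≈dup : ∀ {A B} → SemInjective A B → (x : NF A B) (y : NF (□ ∷ A) B) →
           Sem (lnk □ x) ≐ Sem (dup y) → emb (lnk □ x) ≈ emb (dup y)
lnk□≈dup {A} inj x y eq
  with y' , y≈ , Sy'≐ ← emptyTopRow⇒del y (λ j →
         trans (sym (addColumn-inject₁ isTop (Sem y) _ j))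
           (trans (sym (eq _ (inject₁ j)))
             (trans (extᴿ-fromℕˡ (Sem x) (inject₁ j)) (isTop-inject₁ j))))
  = begin
    app □ (emb x)               ≈⟨ app-cong □ (inj x y' Sx≐Sy') ⟩
    app □ (emb y')              ≈⟨ extend□-∘ε□ (emb y') ⟨
    extend□ (emb y' ∘ₜ ε□ A)    ≈⟨ extend□-cong y≈ ⟨
    extend□ (emb y)             ∎
  where
  open ≈-Reasoning
  Sx≐Sy' : Sem x ≐ Sem y'
  Sx≐Sy' i j = trans (sym (extᴿ-inject₁ (Sem x) i j))
    (trans (eq (inject₁ i) (inject₁ j))
      (trans (addColumn-inject₁ isTop (Sem y) (inject₁ i) j) (sym (Sy'≐ i j))))

lnk◇≈mrg : ∀ {A B} → SemInjective A B → (x : NF A B) (y : NF A (◇ ∷ B)) →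
           Sem (lnk ◇ x) ≐ Sem (mrg y) → emb (lnk ◇ x) ≈ emb (mrg y)
lnk◇≈mrg {B = B} inj x y eq
  with y' , y≈ , Sy'≐ ← emptyTopColumn⇒ins y (λ i →
         trans (sym (addRow-inject₁ isTop (Sem y) i _))
           (trans (sym (eq (inject₁ i) _))
             (trans (extᴿ-fromℕʳ (Sem x) (inject₁ i)) (isTop-inject₁ i))))
  = begin
    app ◇ (emb x)               ≈⟨ app-cong ◇ (inj x y' Sx≐Sy') ⟩
    app ◇ (emb y')              ≈⟨ extend◇-ε◇∘ (emb y') ⟨
    extend◇ (ε◇ B ∘ₜ emb y')    ≈⟨ extend◇-cong y≈ ⟨
    extend◇ (emb y)             ∎
  where
  open ≈-Reasoning
  Sx≐Sy' : Sem x ≐ Sem y'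
  Sx≐Sy' i j = trans (sym (extᴿ-inject₁ (Sem x) i j))
    (trans (eq (inject₁ i) (inject₁ j))
      (trans (addRow-inject₁ isTop (Sem y) i (inject₁ j)) (sym (Sy'≐ i j))))

del≈ins : ∀ {A B} → SemInjective A B → (x : NF A (◇ ∷ B)) (y : NF (□ ∷ A) B) →
          Sem (del x) ≐ Sem (ins y) → emb (del x) ≈ emb (ins y)
del≈ins {A} {B} inj x y eq
  with x' , x≈ , Sx'≐ ← emptyTopColumn⇒ins x (λ i →
         trans (sym (addRow-inject₁ (const false) (Sem x) i _))
           (trans (eq (inject₁ i) _) (addColumn-fromℕ (const false) (Sem y) (inject₁ i))))
     | y' , y≈ , Sy'≐ ← emptyTopRow⇒del y (λ j →
         trans (sym (addColumn-inject₁ (const false) (Sem y) _ j))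
           (trans (sym (eq _ (inject₁ j))) (addRow-fromℕ (const false) (Sem x) (inject₁ j))))
  = begin
    emb x ∘ₜ ε□ A               ≈⟨ ∘-cong ≈-refl x≈ ⟩
    (ε◇ B ∘ₜ emb x') ∘ₜ ε□ A    ≈⟨ ∘-cong ≈-refl (∘-cong (inj x' y' Sx'≐Sy') ≈-refl) ⟩
    (ε◇ B ∘ₜ emb y') ∘ₜ ε□ A    ≈⟨ assoc _ _ _ ⟨
    ε◇ B ∘ₜ (emb y' ∘ₜ ε□ A)    ≈⟨ ∘-cong y≈ ≈-refl ⟨
    ε◇ B ∘ₜ emb y               ∎
  where
  open ≈-Reasoning
  Sx'≐Sy' : Sem x' ≐ Sem y'
  Sx'≐Sy' i j = trans (Sx'≐ i j)
    (trans (sym (addRow-inject₁ (const false) (Sem x) i (inject₁ j)))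
      (trans (eq (inject₁ i) (inject₁ j))
        (trans (addColumn-inject₁ (const false) (Sem y) (inject₁ i) j) (sym (Sy'≐ i j)))))

Sem-injective : ∀ A B → SemInjective A B
Sem-injective [] [] nil nil _ = ≈-refl
Sem-injective [] (◇ ∷ B) (ins x) (ins y) eq =
  ∘-cong (Sem-injective [] B x y (addColumn-injective eq)) ≈-refl
Sem-injective (□ ∷ A) [] (del x) (del y) eq =
  ∘-cong ≈-refl (Sem-injective A [] x y (addRow-injective eq))
Sem-injective (□ ∷ A) (□ ∷ B) (del x) (del y) eq =
  ∘-cong ≈-refl (Sem-injective A (□ ∷ B) x y (addRow-injective eq))
Sem-injective (□ ∷ A) (□ ∷ B) (del x) (lnk □ y) eq =
  contradiction (linksTops-cong (del x) (lnk □ y) eq) λ ()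
Sem-injective (□ ∷ A) (□ ∷ B) (del x) (dup y) eq =
  contradiction (linksTops-cong (del x) (dup y) eq) λ ()
Sem-injective (□ ∷ A) (□ ∷ B) (lnk □ x) (del y) eq =
  contradiction (linksTops-cong (lnk □ x) (del y) eq) λ ()
Sem-injective (□ ∷ A) (□ ∷ B) (lnk □ x) (lnk □ y) eq =
  app-cong □ (Sem-injective A B x y (extᴿ-injective eq))
Sem-injective (□ ∷ A) (□ ∷ B) (lnk □ x) (dup y) eq = lnk□≈dup (Sem-injective A B) x y eq
Sem-injective (□ ∷ A) (□ ∷ B) (dup x) (del y) eq =
  contradiction (linksTops-cong (dup x) (del y) eq) λ ()
Sem-injective (□ ∷ A) (□ ∷ B) (dup x) (lnk □ y) eq =
  ≈-sym (lnk□≈dup (Sem-injective A B) y x (≐-sym eq))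
Sem-injective (□ ∷ A) (□ ∷ B) (dup x) (dup y) eq =
  extend□-cong (Sem-injective (□ ∷ A) B x y (addColumn-injective eq))
Sem-injective (□ ∷ A) (◇ ∷ B) (del x) (del y) eq =
  ∘-cong ≈-refl (Sem-injective A (◇ ∷ B) x y (addRow-injective eq))
Sem-injective (□ ∷ A) (◇ ∷ B) (del x) (ins y) eq = del≈ins (Sem-injective A B) x y eq
Sem-injective (□ ∷ A) (◇ ∷ B) (ins x) (del y) eq =
  ≈-sym (del≈ins (Sem-injective A B) y x (≐-sym eq))
Sem-injective (□ ∷ A) (◇ ∷ B) (ins x) (ins y) eq =
  ∘-cong (Sem-injective (□ ∷ A) B x y (addColumn-injective eq)) ≈-refl
Sem-injective (◇ ∷ A) (◇ ∷ B) (ins x) (ins y) eq =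
  ∘-cong (Sem-injective (◇ ∷ A) B x y (addColumn-injective eq)) ≈-refl
Sem-injective (◇ ∷ A) (◇ ∷ B) (ins x) (lnk ◇ y) eq =
  contradiction (linksTops-cong (ins x) (lnk ◇ y) eq) λ ()
Sem-injective (◇ ∷ A) (◇ ∷ B) (ins x) (mrg y) eq =
  contradiction (linksTops-cong (ins x) (mrg y) eq) λ ()
Sem-injective (◇ ∷ A) (◇ ∷ B) (lnk ◇ x) (ins y) eq =
  contradiction (linksTops-cong (lnk ◇ x) (ins y) eq) λ ()
Sem-injective (◇ ∷ A) (◇ ∷ B) (lnk ◇ x) (lnk ◇ y) eq =
  app-cong ◇ (Sem-injective A B x y (extᴿ-injective eq))
Sem-injective (◇ ∷ A) (◇ ∷ B) (lnk ◇ x) (mrg y) eq = lnk◇≈mrg (Sem-injective A B) x y eq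
Sem-injective (◇ ∷ A) (◇ ∷ B) (mrg x) (ins y) eq =
  contradiction (linksTops-cong (mrg x) (ins y) eq) λ ()
Sem-injective (◇ ∷ A) (◇ ∷ B) (mrg x) (lnk ◇ y) eq =
  ≈-sym (lnk◇≈mrg (Sem-injective A B) y x (≐-sym eq))
Sem-injective (◇ ∷ A) (◇ ∷ B) (mrg x) (mrg y) eq =
  extend◇-cong (Sem-injective A (◇ ∷ B) x y (addRow-injective eq))

mainTheorem2 : {A B : Modality} (f g : Term A B) →
    (∀ i j → G f i j ≡ G g i j) → f ≈ g
mainTheorem2 f g Gf≐Gg = begin
  f             ≈⟨ norm-sound f ⟩
  emb (norm f)  ≈⟨ Sem-injective _ _ (norm f) (norm g) Snf≐Sng ⟩
  emb (norm g)  ≈⟨ norm-sound g ⟨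
  g             ∎
  where
  open ≈-Reasoning
  Snf≐Sng : Sem (norm f) ≐ Sem (norm g)
  Snf≐Sng = ≐-trans (≐-sym (G-norm f)) (≐-trans Gf≐Gg (G-norm g))
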